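{- Let $\mathbf{S}$ be a sequent and let $\mathcal{T}$ be a test. Then the following are equivalent: (1) $\mathcal{T}$ comes from a derivation of $\mathbf{S}$; (2) the interaction between $\mathcal{T}$ and $\neg\mathbf{S}$ does not produce errors.
   Context: Positions are finite sequences of natural numbers; $\langle\rangle$ is the empty one, $\star$ is concatenation, $\langle i\rangle$ is the length-one position. A tree labeled by a set $L$ is a partial function from positions to $L$ whose domain contains $\langle\rangle$ and is closed under prefixes; a leaf is a domain element with no proper extension in the domain; the subtree $T_p$ is $q\mapsto T(p\star q)$ on $\{q: p\star q\in\mathrm{dom}(T)\}$. For a tree labeled by a product $A\times B$, $T_L(p)$ and $T_R(p)$ denote the two components of $T(p)$. Formulas: trees labeled by $\{\vee,\wedge\}\cup\{\mathbf{v}=(+,v)\}\cup\{\neg\mathbf{v}=(-,v)\}$ ($v\in\mathbb{N}$) in which variable-labeled positions are leaves. A compound formula $\mathbf{F}$ with root label $\vee$ (resp. $\wedge$) and arity $I=\{i\in\mathbb{N}:\langle i\rangle\in\mathrm{dom}(\mathbf{F})\}$ is written $\vee_I \mathbf{F}_{\langle i\rangle}$ (resp. $\wedge_I\mathbf{F}_{\langle i\rangle}$); $\vee[\mathbf{F}_0,\dots,\mathbf{F}_{n-1}]$ denotes the disjunctive formula of arity $\{0,\dots,n-1\}$ with immediate subformulas $\mathbf{F}_k$, similarly for $\wedge$. Negation $\neg\mathbf{F}$ swaps $\mathbf{v}\leftrightarrow\neg\mathbf{v}$ and $\vee\leftrightarrow\wedge$ at every position (so $\neg\vee_I\mathbf{F}_{\langle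 i\rangle}=\wedge_I\neg\mathbf{F}_{\langle i\rangle}$). A sequent is a disjunctive formula $\vee[\mathbf{F}_0,\dots,\mathbf{F}_{n-1}]$ ($n\in\mathbb{N}$); for a formula $\mathbf{G}$, $\mathbf{S}\vee\mathbf{G}$ denotes $\vee[\mathbf{F}_0,\dots,\mathbf{F}_{n-1},\mathbf{G}]$. An environment is the negation of a sequent, i.e. $\wedge[\mathbf{G}_0,\dots,\mathbf{G}_{m-1}]$; $\mathbf{E}\wedge\mathbf{H}$ denotes $\wedge[\mathbf{G}_0,\dots,\mathbf{G}_{m-1},\mathbf{H}]$. Rules: axiom rules $(\mathbf{v},k,\ell)$ with $\mathbf{v}$ a positive variable and $k,\ell\in\mathbb{N}$; disjunctive rules $(\vee,k,i_0)$ with $k,i_0\in\mathbb{N}$; conjunctive rules $(\wedge,k)$ with $k\in\mathbb{N}$. A derivation is a tree $T$ labeled by (sequents)$\times$(rules) such that for each $p\in\mathrm{dom}(T)$, writing $T_L(p)=\vee[\mathbf{F}_0,\dots,\mathbf{F}_{n-1}]$, one of: (ax) $T_R(p)=(\mathbf{v},k,\ell)$, $k,\ell<n$, $\mathbf{F}_k=\mathbf{v}$, $\mathbf{F}_\ell=\neg\mathbf{v}$, and $p$ is a leaf; ($\vee$) $T_R(p)=(\vee,k,i_0)$, $k<n$, $\mathbf{F}_k=\vee_I\mathbf{G}_{\langle i\rangle}$, $i_0\in I$, $p\star\langle i\rangle\in\mathrm{dom}(T)$ iff $i=i_0$, and $T_L(p\star\langle i_0\rangle)=T_L(p)\vee\mathbf{G}_{\langle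 i_0\rangle}$; ($\wedge$) $T_R(p)=(\wedge,k)$, $k<n$, $\mathbf{F}_k=\wedge_I\mathbf{G}_{\langle i\rangle}$, $p\star\langle i\rangle\in\mathrm{dom}(T)$ iff $i\in I$, and $T_L(p\star\langle i\rangle)=T_L(p)\vee\mathbf{G}_{\langle i\rangle}$ for all $i\in I$. Derivations may be ill-founded. $\pi$ is a derivation of $\mathbf{S}$ if $\pi_L(\langle\rangle)=\mathbf{S}$. A test is a tree labeled by rules whose domain is the set of all positions. A test $\mathcal{T}$ comes from the derivation $\pi$ of $\mathbf{S}$ if $\mathcal{T}(p)=\pi_R(p)$ for all $p\in\mathrm{dom}(\pi)$. Configurations are pairs (test, environment) or a special symbol $\Uparrow$ (error). The interaction tree $\mathrm{CT}(c)$ of a configuration $c$ is the tree labeled by configurations with root labeled $c$, built as follows for each $p$ in its domain: if the label is $\Uparrow$, $p$ is a leaf. If the label is $(\mathcal{T},\wedge[\mathbf{G}_0,\dots,\mathbf{G}_{m-1}])=(\mathcal{T},\mathbf{E})$: if $\mathcal{T}(\langle\rangle)=(\mathbf{v},k,\ell)$, $k,\ell<m$, $\mathbf{G}_k=\neg\mathbf{v}$, $\mathbf{G}_\ell=\mathbf{v}$, then $p$ is a leaf; if $\mathcal{T}(\langle\rangle)=(\vee,k,i_0)$, $k<m$, $\mathbf{G}_k=\wedge_I\mathbf{H}_{\langle i\rangle}$, $i_0\in I$, then $p$'s only child is $p\star\langle i_0\rangle$, labeled $(\mathcal{T}_{\langle i_0\rangle},\mathbf{E}\wedge\mathbf{H}_{\langle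 i_0\rangle})$; if $\mathcal{T}(\langle\rangle)=(\wedge,k)$, $k<m$, $\mathbf{G}_k=\vee_I\mathbf{H}_{\langle i\rangle}$, then the children of $p$ are $p\star\langle i\rangle$ for $i\in I$, labeled $(\mathcal{T}_{\langle i\rangle},\mathbf{E}\wedge\mathbf{H}_{\langle i\rangle})$; in all other cases, $p$'s only child is $p\star\langle 0\rangle$, labeled $\Uparrow$. The interaction between a test $\mathcal{T}$ and an environment $\mathbf{E}$ does not produce errors if no position of $\mathrm{CT}((\mathcal{T},\mathbf{E}))$ is labeled $\Uparrow$. -}

module Defs where

open import Data.Nat using (ℕ; zero; suc)
open import Data.List using (List; []; _∷_; _++_; [_]; _∷ʳ_; map)
open import Data.List.Relation.Unary.All using (All)
open import Data.List.Relation.Binary.Pointwise using (Pointwise)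
open import Data.Maybe using (Maybe; just; nothing)
import Data.Maybe as Maybe
open import Data.Product using (Σ; _×_; _,_)
open import Data.Unit using (⊤)
open import Data.Empty using (⊥)
open import Relation.Binary.PropositionalEquality using (_≡_; _≢_)
open import Relation.Nullary using (¬_)

-- positions: finite sequences of naturals; ⋆ is _++_, ⟨i⟩ is [ i ]
Pos : Set
Pos = List ℕ

-- a partial function Pos ⇀ L is represented as Pos → Maybe L
-- (nothing = outside the domain)
PTree : Set → Set
PTree L = Pos → Maybe L

Def : {A : Set} → Maybe A → Set
Def (just _) = ⊤
Def nothing  = ⊥

IsTree : {L : Set} → PTree L → Set
IsTree T = Def (T []) × (∀ p q → Def (T (p ++ q)) → Def (T p))

sub : {A : Set} → (Pos → A) → ℕ → (Pos → A)
sub T i q = T (i ∷ q)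

_⇔′_ : Set → Set → Set
A ⇔′ B = (A → B) × (B → A)

data FLab : Set where
  or  : FLab
  and : FLab
  pos : ℕ → FLab
  neg : ℕ → FLab

Fm : Set
Fm = PTree FLab

data IsVarLab : FLab → Set where
  isPos : ∀ v → IsVarLab (pos v)
  isNeg : ∀ v → IsVarLab (neg v)

IsFormula : Fm → Set
IsFormula F = IsTree F ×
  (∀ p l → F p ≡ just l → IsVarLab l → ∀ i q → F (p ++ i ∷ q) ≡ nothing)

_≈F_ : Fm → Fm → Set
F ≈F G = ∀ p → F p ≡ G p

leafF : FLab → Fm
leafF l []      = just l
leafF l (_ ∷ _) = nothing

negLab : FLab → FLab
negLab or      = and
negLab and     = or
negLab (pos v) = neg v
negLab (neg v) = pos v

negF : Fm → Fm
negF F p = Maybe.map negLab (F p)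

-- The sequent ∨[F₀,…,Fₙ₋₁] is represented by the list F₀ ∷ … ∷ Fₙ₋₁,
-- the environment ∧[G₀,…,Gₘ₋₁] by the list G₀ ∷ … ∷ Gₘ₋₁.
-- S ∨ G and E ∧ H are both  _∷ʳ_  (append at the end).

Seq : Set
Seq = List Fm

Env : Set
Env = List Fm

_≈S_ : Seq → Seq → Set
_≈S_ = Pointwise _≈F_

-- ¬∨[F₀,…,Fₙ₋₁] = ∧[¬F₀,…,¬Fₙ₋₁]
negSeq : Seq → Env
negSeq S = map negF S

data Lookup {A : Set} : List A → ℕ → A → Set where
  here  : ∀ {x xs} → Lookup (x ∷ xs) zero x
  there : ∀ {x xs k y} → Lookup xs k y → Lookup (x ∷ xs) (suc k) y

At : {A : Set} → List A → ℕ → (A → Set) → Set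
At {A} Γ k P = Σ A (λ F → Lookup Γ k F × P F)

data Rule : Set where
  ax   : (v k ℓ : ℕ) → Rule
  disj : (k i₀ : ℕ) → Rule
  conj : (k : ℕ) → Rule

DTree : Set
DTree = PTree (Seq × Rule)

RuleOK : DTree → Pos → Seq → Rule → Set
RuleOK π p Γ (ax v k ℓ) =
  At Γ k (λ F → F ≈F leafF (pos v)) ×
  At Γ ℓ (λ F → F ≈F leafF (neg v)) ×
  (∀ i q → π (p ++ i ∷ q) ≡ nothing)
RuleOK π p Γ (disj k i₀) =
  Σ Fm λ F → Lookup Γ k F × F [] ≡ just or × Def (F [ i₀ ]) ×
    (∀ i → Def (π (p ++ [ i ])) ⇔′ (i ≡ i₀)) ×
    (∀ Δ r → π (p ++ [ i₀ ]) ≡ just (Δ , r) → Δ ≈S (Γ ∷ʳ sub F i₀))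
RuleOK π p Γ (conj k) =
  Σ Fm λ F → Lookup Γ k F × F [] ≡ just and ×
    (∀ i → Def (π (p ++ [ i ])) ⇔′ Def (F [ i ])) ×
    (∀ i Δ r → π (p ++ [ i ]) ≡ just (Δ , r) → Δ ≈S (Γ ∷ʳ sub F i))

IsDerivation : DTree → Set
IsDerivation π = IsTree π ×
  (∀ p Γ r → π p ≡ just (Γ , r) → All IsFormula Γ × RuleOK π p Γ r)

DerivationOf : DTree → Seq → Set
DerivationOf π S = IsDerivation π ×
  Σ Seq λ Γ → Σ Rule λ r → π [] ≡ just (Γ , r) × Γ ≈S S

Test : Set
Test = Pos → Rule

ComesFrom : Test → Seq → Set
ComesFrom 𝒯 S = Σ DTree λ π → DerivationOf π S ×
  (∀ p Γ r → π p ≡ just (Γ , r) → 𝒯 p ≡ r)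

data Config : Set where
  err : Config
  cfg : Test → Env → Config

AxGuard : Test → Env → Set
AxGuard 𝒯 E = Σ ℕ λ v → Σ ℕ λ k → Σ ℕ λ ℓ → 𝒯 [] ≡ ax v k ℓ ×
  At E k (λ G → G ≈F leafF (neg v)) × At E ℓ (λ G → G ≈F leafF (pos v))

DisjGuard : Test → Env → Set
DisjGuard 𝒯 E = Σ ℕ λ k → Σ ℕ λ i₀ → 𝒯 [] ≡ disj k i₀ ×
  At E k (λ G → G [] ≡ just and × Def (G [ i₀ ]))

ConjGuard : Test → Env → Set
ConjGuard 𝒯 E = Σ ℕ λ k → 𝒯 [] ≡ conj k × At E k (λ G → G [] ≡ just or)

-- Child c i c' : in CT(c), the position ⟨i⟩ exists and is labelled c'
data Child : Config → ℕ → Config → Set where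
  c-disj : ∀ {𝒯 E k i₀ G} → 𝒯 [] ≡ disj k i₀ → Lookup E k G →
           G [] ≡ just and → Def (G [ i₀ ]) →
           Child (cfg 𝒯 E) i₀ (cfg (sub 𝒯 i₀) (E ∷ʳ sub G i₀))
  c-conj : ∀ {𝒯 E k G i} → 𝒯 [] ≡ conj k → Lookup E k G →
           G [] ≡ just or → Def (G [ i ]) →
           Child (cfg 𝒯 E) i (cfg (sub 𝒯 i) (E ∷ʳ sub G i))
  c-err  : ∀ {𝒯 E} → ¬ AxGuard 𝒯 E → ¬ DisjGuard 𝒯 E → ¬ ConjGuard 𝒯 E →
           Child (cfg 𝒯 E) 0 err

-- CTLab c p c' : p ∈ dom CT(c) and CT(c)(p) = c'
-- (uses CT(c)_⟨i⟩ = CT(label of ⟨i⟩), which holds by construction)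
data CTLab : Config → Pos → Config → Set where
  root : ∀ {c} → CTLab c [] c
  step : ∀ {c i c' p c''} → Child c i c' → CTLab c' p c'' → CTLab c (i ∷ p) c''

NoErrors : Test → Env → Set
NoErrors 𝒯 E = ∀ p → ¬ CTLab (cfg 𝒯 E) p err

module Submission where

-- Both directions compare a derivation with the interaction tree CT((𝒯, ¬S)) node by
-- node.  At corresponding nodes the derivation holds a sequent Γ and the interaction an
-- environment E which is, component by component, the negation of Γ (written E ≈¬ Γ).
-- The local fact everything rests on: a rule r is *applicable* to Γ (its principal
-- formulas are where r says) iff the environment E *responds* to r (the interaction
-- does not step to the error ⇑); and then the premises of r on Γ are matched by the
-- children of the interaction node, again related by ≈¬.
--   (1) ⇒ (2)  Walking down an interaction path alongside the derivation, every node
--              stays *tracked* by a subderivation whose root rule is correct, so no step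
--              of the path can produce ⇑.
--   (2) ⇒ (1)  The *canonical derivation* canon S 𝒯 labels every position by the sequent
--              reached from S by applying the rules of 𝒯.  Absence of errors makes every
--              rule along the way applicable, so canon S 𝒯 is a derivation of S and 𝒯
--              comes from it.  "No error" only yields a response up to double negation;
--              responses are stable since all their ingredients are decidable.

open import Defs
open import Data.Nat using (ℕ; zero; suc)
import Data.Nat as ℕ
open import Data.List using (List; []; _∷_; _++_; [_]; _∷ʳ_)
open import Data.List.Relation.Unary.All using (All; _∷_)
open import Data.List.Relation.Unary.All.Properties using (∷ʳ⁺)
open import Data.List.Relation.Binary.Pointwise using (Pointwise; []; _∷_; ++⁺; symmetric)
  renaming (refl to pw-refl)
open import Data.Maybe using (Maybe; just; nothing; _>>=_)
import Data.Maybe as Maybe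
open import Data.Maybe.Properties using (≡-dec; just-injective)
open import Data.Product using (Σ; _×_; _,_; proj₁; proj₂)
open import Data.Sum using (_⊎_; inj₁; inj₂) renaming ([_,_]′ to either)
open import Data.Unit using (tt)
open import Data.Empty using (⊥; ⊥-elim)
open import Function using (_∘_; flip)
open import Relation.Binary.Definitions using (DecidableEquality)
open import Relation.Binary.PropositionalEquality using (_≡_; refl; sym; trans; cong; subst)
open import Relation.Nullary using (¬_; Dec; yes; no)
open import Relation.Nullary.Decidable using (map′; _×-dec_; decidable-stable)
open import Relation.Nullary.Negation using (Stable; ¬¬-map)

private
  variable
    A B : Set
    x y : A
    xs : List A
    k i i₀ : ℕ
    p q : Pos
    l : FLab
    F G : Fm
    Γ Δ : Seq
    E : Env
    r : Rule
    π : DTree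
    𝒯 : Test
    c c' : Config

nth : List A → ℕ → Maybe A
nth []       _       = nothing
nth (x ∷ _)  zero    = just x
nth (_ ∷ xs) (suc k) = nth xs k

nth-sound : nth xs k ≡ just x → Lookup xs k x
nth-sound {xs = _ ∷ _} {zero}  refl = here
nth-sound {xs = _ ∷ _} {suc k} e    = there (nth-sound e)

nth-complete : Lookup xs k x → nth xs k ≡ just x
nth-complete here      = refl
nth-complete (there l) = nth-complete l

lookup-unique : Lookup xs k x → Lookup xs k y → x ≡ y
lookup-unique here      here       = refl
lookup-unique (there l) (there l') = lookup-unique l l'

lookup-all : {P : A → Set} → All P xs → Lookup xs k x → P x
lookup-all (px ∷ _)  here      = px
lookup-all (_ ∷ pxs) (there l) = lookup-all pxs l

lookup-pw : {R : A → B → Set} {ys : List B} →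
  Pointwise R xs ys → Lookup xs k x → Σ B λ y → Lookup ys k y × R x y
lookup-pw (rxy ∷ _) here      = _ , here , rxy
lookup-pw (_ ∷ rel) (there l) with lookup-pw rel l
... | y , l' , rxy = y , there l' , rxy

at-pw : {R : A → B → Set} {ys : List B} {P : A → Set} {Q : B → Set} →
  Pointwise R xs ys → (∀ {x y} → R x y → P x → Q y) → At xs k P → At ys k Q
at-pw rel f (_ , l , px) with lookup-pw rel l
... | y , l' , rxy = y , l' , f rxy px

-- Existence of a component with a stable property is stable: the list decides which
-- component is meant.
at-stable : {P : A → Set} → (∀ x → Stable (P x)) → ∀ xs k → Stable (At xs k P)
at-stable st []       k       ¬¬at = ⊥-elim (¬¬at λ { (_ , () , _) })
at-stable st (x ∷ xs) zero    ¬¬at = x , here , st x (¬¬-map (λ { (_ , here , px) → px }) ¬¬at)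
at-stable {P = P} st (x ∷ xs) (suc k) ¬¬at = grow (at-stable st xs k (¬¬-map shrink ¬¬at))
  where
  shrink : At (x ∷ xs) (suc k) P → At xs k P
  shrink (y , there l , py) = y , l , py
  grow : At xs k P → At (x ∷ xs) (suc k) P
  grow (y , l , py) = y , there l , py

def? : (m : Maybe A) → Dec (Def m)
def? (just _) = yes tt
def? nothing  = no λ ()

def-witness : (m : Maybe A) → Def m → Σ A λ a → m ≡ just a
def-witness (just a) _ = a , refl

undefined : {m : Maybe A} → ¬ Def m → m ≡ nothing
undefined {m = just _}  u = ⊥-elim (u tt)
undefined {m = nothing} _ = refl

def-map : {f : A → B} {m : Maybe A} → Def (Maybe.map f m) ⇔′ Def m
def-map {m = just _}  = (λ _ → tt) , (λ _ → tt)
def-map {m = nothing} = (λ ()) , (λ ())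

def-just : {m : Maybe A} → m ≡ just x → Def m
def-just refl = tt

def-resp : {m m' : Maybe A} → m ≡ m' → Def m ⇔′ Def m'
def-resp refl = (λ d → d) , (λ d → d)

def-iff-resp : {m m' : Maybe A} {P : Set} → m ≡ m' → Def m ⇔′ P → Def m' ⇔′ P
def-iff-resp refl iff = iff

-- Label equality is decidable; this makes responses stable.
_≟L_ : DecidableEquality FLab
or    ≟L or    = yes refl
and   ≟L and   = yes refl
pos v ≟L pos w = map′ (cong pos) (λ { refl → refl }) (v ℕ.≟ w)
neg v ≟L neg w = map′ (cong neg) (λ { refl → refl }) (v ℕ.≟ w)
or    ≟L and   = no λ ()
or    ≟L pos _ = no λ ()
or    ≟L neg _ = no λ ()
and   ≟L or    = no λ ()
and   ≟L pos _ = no λ ()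
and   ≟L neg _ = no λ ()
pos _ ≟L or    = no λ ()
pos _ ≟L and   = no λ ()
pos _ ≟L neg _ = no λ ()
neg _ ≟L or    = no λ ()
neg _ ≟L and   = no λ ()
neg _ ≟L pos _ = no λ ()

negLab-involutive : ∀ l → negLab (negLab l) ≡ l
negLab-involutive or      = refl
negLab-involutive and     = refl
negLab-involutive (pos _) = refl
negLab-involutive (neg _) = refl

negLab-injective : {l l' : FLab} → negLab l ≡ negLab l' → l ≡ l'
negLab-injective {l} {l'} e =
  trans (sym (negLab-involutive l)) (trans (cong negLab e) (negLab-involutive l'))

negM-injective : {m m' : Maybe FLab} → Maybe.map negLab m ≡ Maybe.map negLab m' → m ≡ m'
negM-injective {just _}  {just _}  e    = cong just (negLab-injective (just-injective e))
negM-injective {nothing} {nothing} refl = refl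

leaf-neg : ∀ l q → Maybe.map negLab (leafF l q) ≡ leafF (negLab l) q
leaf-neg l []      = refl
leaf-neg l (_ ∷ _) = refl

record _≈¬F_ (G F : Fm) : Set where
  constructor dual
  field pointwise : G ≈F negF F

_≈¬_ : Env → Seq → Set
_≈¬_ = Pointwise _≈¬F_

dual-label : G ≈¬F F → F p ≡ just l → G p ≡ just (negLab l)
dual-label {p = p} (dual d) e = trans (d p) (cong (Maybe.map negLab) e)

dual-label⁻ : G ≈¬F F → G p ≡ just (negLab l) → F p ≡ just l
dual-label⁻ {p = p} (dual d) e = negM-injective (trans (sym (d p)) e)

dual-def : G ≈¬F F → Def (F p) ⇔′ Def (G p)
dual-def {p = p} (dual d) =
  (λ dF → proj₂ (def-resp (d p)) (proj₂ def-map dF)) , (λ dG → proj₁ def-map (proj₁ (def-resp (d p)) dG))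

dual-leaf : G ≈¬F F → F ≈F leafF l → G ≈F leafF (negLab l)
dual-leaf {l = l} (dual d) e q = trans (d q) (trans (cong (Maybe.map negLab) (e q)) (leaf-neg l q))

dual-leaf⁻ : G ≈¬F F → G ≈F leafF (negLab l) → F ≈F leafF l
dual-leaf⁻ {l = l} (dual d) e q = negM-injective (trans (sym (d q)) (trans (e q) (sym (leaf-neg l q))))

negSeq-≈¬ : ∀ Γ → negSeq Γ ≈¬ Γ
negSeq-≈¬ []      = []
negSeq-≈¬ (_ ∷ Γ) = dual (λ _ → refl) ∷ negSeq-≈¬ Γ

≈S-reflexive : Δ ≡ Γ → Δ ≈S Γ
≈S-reflexive refl = pw-refl (λ _ → refl)

≈¬-resp : E ≈¬ Γ → Δ ≈S Γ → E ≈¬ Δ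
≈¬-resp []               []        = []
≈¬-resp (dual d ∷ rel) (e ∷ eqs) =
  dual (λ p → trans (d p) (cong (Maybe.map negLab) (sym (e p)))) ∷ ≈¬-resp rel eqs

≈¬-lookup : E ≈¬ Γ → Lookup E k G → Lookup Γ k F → G ≈¬F F
≈¬-lookup rel lE lΓ with lookup-pw rel lE
... | _ , lΓ' , d rewrite lookup-unique lΓ lΓ' = d

≈¬-flip : E ≈¬ Γ → Pointwise (flip _≈¬F_) Γ E
≈¬-flip = symmetric (λ d → d)

≈¬-partner : E ≈¬ Γ → Lookup Γ k F → Σ Fm λ G → Lookup E k G × G ≈¬F F
≈¬-partner rel = lookup-pw (≈¬-flip rel)

≈¬-snoc : E ≈¬ Γ → G ≈¬F F → (E ∷ʳ sub G i) ≈¬ (Γ ∷ʳ sub F i)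
≈¬-snoc {i = i} rel (dual d) = ++⁺ rel (dual (λ q → d (i ∷ q)) ∷ [])

Applicable : Rule → Seq → Set
Applicable (ax v k ℓ) Γ = At Γ k (_≈F leafF (pos v)) × At Γ ℓ (_≈F leafF (neg v))
Applicable (disj k i₀) Γ = At Γ k (λ F → F [] ≡ just or × Def (F [ i₀ ]))
Applicable (conj k)    Γ = At Γ k (λ F → F [] ≡ just and)

Responds : Rule → Env → Set
Responds (ax v k ℓ) E = At E k (_≈F leafF (neg v)) × At E ℓ (_≈F leafF (pos v))
Responds (disj k i₀) E = At E k (λ G → G [] ≡ just and × Def (G [ i₀ ]))
Responds (conj k)    E = At E k (λ G → G [] ≡ just or)

applicable→responds : E ≈¬ Γ → Applicable r Γ → Responds r E
applicable→responds {r = ax v k ℓ} rel (a , b) =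
  at-pw (≈¬-flip rel) dual-leaf a , at-pw (≈¬-flip rel) dual-leaf b
applicable→responds {r = disj k i₀} rel a =
  at-pw (≈¬-flip rel) (λ d (o , def) → dual-label d o , proj₁ (dual-def d) def) a
applicable→responds {r = conj k} rel a =
  at-pw (≈¬-flip rel) dual-label a

responds→applicable : E ≈¬ Γ → Responds r E → Applicable r Γ
responds→applicable {r = ax v k ℓ} rel (a , b) =
  at-pw rel (dual-leaf⁻ {l = pos v}) a , at-pw rel (dual-leaf⁻ {l = neg v}) b
responds→applicable {r = disj k i₀} rel a =
  at-pw rel (λ d (n , def) → dual-label⁻ {l = or} d n , proj₂ (dual-def d) def) a
responds→applicable {r = conj k} rel a =
  at-pw rel (dual-label⁻ {l = and}) a

-- Responses are stable: labels and definedness are decidable, leaf equality is a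
-- conjunction of decidable facts, and the component is determined by its index.
responds-stable : ∀ r E → Stable (Responds r E)
responds-stable (ax v k ℓ) E ¬¬resp =
  at-stable (leaf-stable (neg v)) E k (¬¬-map proj₁ ¬¬resp) ,
  at-stable (leaf-stable (pos v)) E ℓ (¬¬-map proj₂ ¬¬resp)
  where
  leaf-stable : ∀ l G → Stable (G ≈F leafF l)
  leaf-stable l G ¬¬eq q =
    decidable-stable (≡-dec _≟L_ (G q) (leafF l q)) (¬¬-map (λ eq → eq q) ¬¬eq)
responds-stable (disj k i₀) E =
  at-stable (λ G → decidable-stable (≡-dec _≟L_ (G []) (just and) ×-dec def? (G [ i₀ ]))) E k
responds-stable (conj k) E =
  at-stable (λ G → decidable-stable (≡-dec _≟L_ (G []) (just or))) E k

responds→guard : 𝒯 [] ≡ r → Responds r E → AxGuard 𝒯 E ⊎ DisjGuard 𝒯 E ⊎ ConjGuard 𝒯 E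
responds→guard {r = ax v k ℓ} e (a , b) = inj₁ (v , k , ℓ , e , a , b)
responds→guard {r = disj k i₀} e a     = inj₂ (inj₁ (k , i₀ , e , a))
responds→guard {r = conj k}    e a     = inj₂ (inj₂ (k , e , a))

responds→noError : 𝒯 [] ≡ r → Responds r E → ¬ Child (cfg 𝒯 E) i err
responds→noError {𝒯 = 𝒯} e resp (c-err ¬ax ¬disj ¬conj) =
  either ¬ax (either ¬disj ¬conj) (responds→guard {𝒯 = 𝒯} e resp)

noErrors→responds : NoErrors 𝒯 E → Responds (𝒯 []) E
noErrors→responds {𝒯} {E} noErr = responds-stable (𝒯 []) E λ ¬resp →
  noErr [ 0 ] (step (c-err (¬resp ∘ axResp) (¬resp ∘ disjResp) (¬resp ∘ conjResp)) root)
  where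
  axResp : AxGuard 𝒯 E → Responds (𝒯 []) E
  axResp (_ , _ , _ , e , a , b) rewrite e = a , b
  disjResp : DisjGuard 𝒯 E → Responds (𝒯 []) E
  disjResp (_ , _ , e , a) rewrite e = a
  conjResp : ConjGuard 𝒯 E → Responds (𝒯 []) E
  conjResp (_ , e , a) rewrite e = a

noErrors→applicable : E ≈¬ Γ → NoErrors 𝒯 E → Applicable (𝒯 []) Γ
noErrors→applicable rel noErr = responds→applicable rel (noErrors→responds noErr)

noErrors-child : {𝒯' : Test} {E' : Env} →
  NoErrors 𝒯 E → Child (cfg 𝒯 E) i (cfg 𝒯' E') → NoErrors 𝒯' E'
noErrors-child {i = i} noErr ch q path = noErr (i ∷ q) (step ch path)

-- Every node of π carries formulas and a correctly applied rule (the second half of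
-- IsDerivation).
LocallyCorrect : DTree → Set
LocallyCorrect π = ∀ p Γ r → π p ≡ just (Γ , r) → All IsFormula Γ × RuleOK π p Γ r

-- The test 𝒯 agrees with the rules of π (the last clause of ComesFrom).
Agrees : Test → DTree → Set
Agrees 𝒯 π = ∀ p Γ r → π p ≡ just (Γ , r) → 𝒯 p ≡ r

ruleOK→applicable : ∀ r → RuleOK π p Γ r → Applicable r Γ
ruleOK→applicable (ax v k ℓ) (a , b , _)         = a , b
ruleOK→applicable (disj k i₀) (F , l , o , d , _) = F , l , o , d
ruleOK→applicable (conj k) (F , l , a , _)        = F , l , a

-- Correctness of a node only depends on the subtree rooted there.
ruleOK-resp : {π' : DTree} {p' : Pos} → (∀ x → π (p ++ x) ≡ π' (p' ++ x)) →
  ∀ r → RuleOK π p Γ r → RuleOK π' p' Γ r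
ruleOK-resp eq (ax v k ℓ) (a , b , leaf) = a , b , λ i q → trans (sym (eq (i ∷ q))) (leaf i q)
ruleOK-resp eq (disj k i₀) (F , l , o , d , iff , premises) =
  F , l , o , d , (λ i → def-iff-resp (eq [ i ]) (iff i)) , λ Δ r e → premises Δ r (trans (eq [ i₀ ]) e)
ruleOK-resp eq (conj k) (F , l , a , iff , premises) =
  F , l , a , (λ i → def-iff-resp (eq [ i ]) (iff i)) , λ i Δ r e → premises i Δ r (trans (eq [ i ]) e)

locallyCorrect-sub : LocallyCorrect π → ∀ i → LocallyCorrect (sub π i)
locallyCorrect-sub lc i p Γ r e with lc (i ∷ p) Γ r e
... | fs , ok = fs , ruleOK-resp (λ _ → refl) r ok

data Extends (Γ : Seq) (k i : ℕ) : Seq → Set where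
  extends : Lookup Γ k F → Def (F [ i ]) → Extends Γ k i (Γ ∷ʳ sub F i)

extend : Seq → ℕ → ℕ → Maybe Seq
extend Γ k i = nth Γ k >>= λ F → Maybe.map (λ _ → Γ ∷ʳ sub F i) (F [ i ])

extend-sound : extend Γ k i ≡ just Δ → Extends Γ k i Δ
extend-sound {Γ} {k} {i} e with nth Γ k in found
... | just F with F [ i ] in defined
extend-sound refl | just F | just _ = extends (nth-sound found) (def-just defined)

extend-complete : Extends Γ k i Δ → extend Γ k i ≡ just Δ
extend-complete {i = i} (extends {F = F} l d) rewrite nth-complete l with F [ i ]
... | just _ = refl

extends-unique : Lookup Γ k F → Extends Γ k i Δ → Δ ≡ Γ ∷ʳ sub F i
extends-unique l (extends l' _) rewrite lookup-unique l l' = refl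

extends-def : Lookup Γ k F → Extends Γ k i Δ → Def (F [ i ])
extends-def l (extends l' d) rewrite lookup-unique l l' = d

extends-formulas : All IsFormula Γ → Extends Γ k i Δ → All IsFormula Δ
extends-formulas {i = i} fs (extends l d) with lookup-all fs l
... | ((_ , prefix) , leaves) = ∷ʳ⁺ fs ((d , λ p q → prefix (i ∷ p) q) , λ p → leaves (i ∷ p))

-- The premise of Γ along branch i of rule r, if that branch exists.  Root labels are not
-- checked here: they are guaranteed wherever r is applicable.
premise : Seq → Rule → ℕ → Maybe Seq
premise Γ (ax _ _ _) i = nothing
premise Γ (disj k i₀) i with i ℕ.≟ i₀
... | yes _ = extend Γ k i
... | no _  = nothing
premise Γ (conj k) i = extend Γ k i

premise-disj : premise Γ (disj k i₀) i ≡ just Δ → i ≡ i₀ × Extends Γ k i Δ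
premise-disj {i₀ = i₀} {i = i} e with i ℕ.≟ i₀
... | yes i≡i₀ = i≡i₀ , extend-sound e

premise-disj-at : Extends Γ k i₀ Δ → premise Γ (disj k i₀) i₀ ≡ just Δ
premise-disj-at {i₀ = i₀} ext with i₀ ℕ.≟ i₀
... | yes _  = extend-complete ext
... | no i≢i = ⊥-elim (i≢i refl)

premise-extends : premise Γ r i ≡ just Δ → Σ ℕ λ k → Extends Γ k i Δ
premise-extends {r = disj k _} e = k , proj₂ (premise-disj e)
premise-extends {r = conj k}   e = k , extend-sound e

record ChildrenArePremises (π : DTree) (Γ : Seq) (r : Rule) : Set where
  constructor childrenArePremises
  field children : ∀ i → Maybe.map proj₁ (π [ i ]) ≡ premise Γ r i

children-def : ChildrenArePremises π Γ r → ∀ i → Def (π [ i ]) ⇔′ Def (premise Γ r i)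
children-def (childrenArePremises children) i =
  (λ d → proj₁ (def-resp (children i)) (proj₂ def-map d)) ,
  (λ d → proj₁ def-map (proj₂ (def-resp (children i)) d))

children-premise : {r' : Rule} → ChildrenArePremises π Γ r →
  π [ i ] ≡ just (Δ , r') → premise Γ r i ≡ just Δ
children-premise {i = i} (childrenArePremises children) e =
  trans (sym (children i)) (cong (Maybe.map proj₁) e)

rootCorrect : ∀ r → IsTree π → Applicable r Γ → ChildrenArePremises π Γ r → RuleOK π [] Γ r
rootCorrect (ax v k ℓ) (_ , prefix) (a , b) children =
  a , b , λ i q → undefined (λ d → proj₁ (children-def children i) (prefix [ i ] q d))
rootCorrect {π} {Γ} (disj k i₀) _ (F , l , o , d) children = F , l , o , d , iff , premises
  where
  iff : ∀ i → Def (π [ i ]) ⇔′ (i ≡ i₀)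
  iff i = (λ dπ → proj₁ (premise-disj (proj₂ (def-witness _ (proj₁ (children-def children i) dπ)))))
        , λ { refl → proj₂ (children-def children i₀) (def-just (premise-disj-at (extends l d))) }
  premises : ∀ Δ r' → π [ i₀ ] ≡ just (Δ , r') → Δ ≈S (Γ ∷ʳ sub F i₀)
  premises Δ r' e = ≈S-reflexive (extends-unique l (proj₂ (premise-disj (children-premise children e))))
rootCorrect {π} {Γ} (conj k) _ (F , l , a) children = F , l , a , iff , premises
  where
  iff : ∀ i → Def (π [ i ]) ⇔′ Def (F [ i ])
  iff i = (λ dπ → extends-def l (extend-sound (proj₂ (def-witness _
                      (proj₁ (children-def children i) dπ)))))
        , λ dF → proj₂ (children-def children i) (def-just (extend-complete (extends l dF)))
  premises : ∀ i Δ r' → π [ i ] ≡ just (Δ , r') → Δ ≈S (Γ ∷ʳ sub F i)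
  premises i Δ r' e = ≈S-reflexive (extends-unique l (extend-sound (children-premise children e)))

-- (1) ⇒ (2): interaction paths stay tracked by subderivations

Tracks : DTree → Config → Set
Tracks π err        = ⊥
Tracks π (cfg 𝒯 E) = Agrees 𝒯 π × Σ Seq λ Γ → Σ Rule λ r → π [] ≡ just (Γ , r) × E ≈¬ Γ

descend : Agrees 𝒯 π → E ≈¬ Γ → Lookup E k G → Lookup Γ k F → Def (π [ i ]) →
  (∀ Δ r' → π [ i ] ≡ just (Δ , r') → Δ ≈S (Γ ∷ʳ sub F i)) →
  Tracks (sub π i) (cfg (sub 𝒯 i) (E ∷ʳ sub G i))
descend {π = π} {i = i} agree rel lE lΓ d premises with def-witness (π [ i ]) d
... | (Δ , r) , e =
  (λ p → agree (i ∷ p)) , Δ , r , e , ≈¬-resp (≈¬-snoc rel (≈¬-lookup rel lE lΓ)) (premises Δ r e)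

tracks-child : LocallyCorrect π → Tracks π c → Child c i c' → Tracks (sub π i) c'
tracks-child lc (agree , Γ , r , atRoot , rel) (c-err {𝒯 = 𝒯} ¬ax ¬disj ¬conj) =
  responds→noError {𝒯 = 𝒯} (agree [] Γ r atRoot)
    (applicable→responds rel (ruleOK→applicable r (proj₂ (lc [] Γ r atRoot))))
    (c-err ¬ax ¬disj ¬conj)
tracks-child lc (agree , Γ , r , atRoot , rel) (c-disj e lE _ _)
  with trans (sym (agree [] Γ r atRoot)) e
... | refl with proj₂ (lc [] Γ r atRoot)
...   | _ , lΓ , _ , _ , iff , premises = descend agree rel lE lΓ (proj₂ (iff _) refl) premises
tracks-child lc (agree , Γ , r , atRoot , rel) (c-conj {i = i} e lE _ Gdef)
  with trans (sym (agree [] Γ r atRoot)) e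
... | refl with proj₂ (lc [] Γ r atRoot)
...   | _ , lΓ , _ , iff , premises =
  descend agree rel lE lΓ (proj₂ (iff i) (proj₂ (dual-def (≈¬-lookup rel lE lΓ)) Gdef)) (premises i)

tracked-noError : LocallyCorrect π → Tracks π c → ¬ CTLab c q err
tracked-noError lc ()  root
tracked-noError lc tr (step {i = i} ch path) =
  tracked-noError (locallyCorrect-sub lc i) (tracks-child lc tr ch) path

comesFrom→noErrors : ∀ S → ComesFrom 𝒯 S → NoErrors 𝒯 (negSeq S)
comesFrom→noErrors S (π , ((_ , lc) , Γ , r , atRoot , Γ≈S) , agree) q =
  tracked-noError lc (agree , Γ , r , atRoot , ≈¬-resp (negSeq-≈¬ S) Γ≈S)

-- (2) ⇒ (1): the canonical derivation

canon : Seq → Test → DTree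
canon Γ 𝒯 []      = just (Γ , 𝒯 [])
canon Γ 𝒯 (i ∷ p) = premise Γ (𝒯 []) i >>= λ Δ → canon Δ (sub 𝒯 i) p

-- canon Γ 𝒯 is a tree, its rules are those of 𝒯, and its root's children are the
-- premises.  (Positions through a missing premise are undefined, so those cases are
-- absurd and omitted.)
canon-prefix : ∀ Γ 𝒯 p q → Def (canon Γ 𝒯 (p ++ q)) → Def (canon Γ 𝒯 p)
canon-prefix Γ 𝒯 []      q _ = tt
canon-prefix Γ 𝒯 (i ∷ p) q d with premise Γ (𝒯 []) i
... | just Δ = canon-prefix Δ (sub 𝒯 i) p q d

canon-tree : ∀ Γ 𝒯 → IsTree (canon Γ 𝒯)
canon-tree Γ 𝒯 = tt , canon-prefix Γ 𝒯

canon-agrees : ∀ Γ 𝒯 → Agrees 𝒯 (canon Γ 𝒯)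
canon-agrees Γ 𝒯 []      _  _ refl = refl
canon-agrees Γ 𝒯 (i ∷ p) Δ' r e with premise Γ (𝒯 []) i
... | just Δ = canon-agrees Δ (sub 𝒯 i) p Δ' r e

canon-children : ∀ Γ 𝒯 → ChildrenArePremises (canon Γ 𝒯) Γ (𝒯 [])
canon-children Γ 𝒯 = childrenArePremises label
  where
  label : ∀ i → Maybe.map proj₁ (canon Γ 𝒯 [ i ]) ≡ premise Γ (𝒯 []) i
  label i with premise Γ (𝒯 []) i
  ... | just _  = refl
  ... | nothing = refl

canon-sub : premise Γ (𝒯 []) i ≡ just Δ → ∀ x → canon Δ (sub 𝒯 i) x ≡ canon Γ 𝒯 (i ∷ x)
canon-sub eq x rewrite eq = refl

premise-child : E ≈¬ Γ → 𝒯 [] ≡ r → Applicable r Γ → premise Γ r i ≡ just Δ →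
  Σ Env λ E' → Child (cfg 𝒯 E) i (cfg (sub 𝒯 i) E') × E' ≈¬ Δ
premise-child {r = disj k i₀} {i = i} rel e (F , l , o , d) found
  with premise-disj {i₀ = i₀} {i = i} found
... | refl , ext with extends-unique l ext | ≈¬-partner rel l
... | refl | G , lE , dG =
  _ , c-disj e lE (dual-label dG o) (proj₁ (dual-def dG) d) , ≈¬-snoc rel dG
premise-child {r = conj k} rel e (F , l , a) found with extend-sound found
... | ext with extends-unique l ext | ≈¬-partner rel l
... | refl | G , lE , dG =
  _ , c-conj e lE (dual-label dG a) (proj₁ (dual-def dG) (extends-def l ext)) , ≈¬-snoc rel dG

-- If the interaction of 𝒯 with an environment negating Γ never errs, the canonical
-- derivation of Γ is locally correct: at each node the rule of 𝒯 is applicable, and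
-- the subtree below branch i is the canonical derivation of the i-th premise.
canon-correct : E ≈¬ Γ → All IsFormula Γ → NoErrors 𝒯 E → LocallyCorrect (canon Γ 𝒯)
canon-correct {Γ = Γ} {𝒯 = 𝒯} rel fs noErr [] _ _ refl =
  fs , rootCorrect (𝒯 []) (canon-tree Γ 𝒯) (noErrors→applicable rel noErr) (canon-children Γ 𝒯)
canon-correct {Γ = Γ} {𝒯 = 𝒯} rel fs noErr (i ∷ p) Δ' r e with premise Γ (𝒯 []) i in found
... | just Δ
  with premise-child {𝒯 = 𝒯} {i = i} rel refl (noErrors→applicable rel noErr) found
... | _ , child , rel'
  with canon-correct rel' (extends-formulas fs (proj₂ (premise-extends {r = 𝒯 []} found)))
                          (noErrors-child noErr child) p Δ' r e
... | fs' , ok = fs' , ruleOK-resp (λ x → canon-sub {𝒯 = 𝒯} found (p ++ x)) r ok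

noErrors→comesFrom : ∀ S → All IsFormula S → NoErrors 𝒯 (negSeq S) → ComesFrom 𝒯 S
noErrors→comesFrom {𝒯} S fs noErr =
  canon S 𝒯 ,
  ((canon-tree S 𝒯 , canon-correct (negSeq-≈¬ S) fs noErr) , S , 𝒯 [] , refl , ≈S-reflexive refl) ,
  canon-agrees S 𝒯

mainTheorem2 : (S : Seq) → All IsFormula S → (𝒯 : Test) →
    (ComesFrom 𝒯 S → NoErrors 𝒯 (negSeq S)) × (NoErrors 𝒯 (negSeq S) → ComesFrom 𝒯 S)
mainTheorem2 S fs 𝒯 = comesFrom→noErrors S , noErrors→comesFrom S fs
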